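{- Let $\{(\mathcal{C}_i,P_i)\}_{i\in I}\subseteq\mathrm{Ob}(\mathbf{FA})$. Then $\models_{(\prod_I\mathcal{C}_i,\prod_IP_i)}\ \supseteq\ \models_{\{(\mathcal{C}_i,P_i)\}_{i\in I}}$: for all theories $T,T'$ over a common signature, if $T\models_{\{(\mathcal{C}_i,P_i)\}_{i\in I}}T'$ then $T\models_{(\prod_I\mathcal{C}_i,\prod_IP_i)}T'$.
   Context: Syntax: first-order language $\mathscr{L}$ (quantifiers $\mathscr{L}_q$, connectives $\mathscr{L}_\omega$ with arities, designated $e\in\mathscr{L}_0$, $\otimes\in\mathscr{L}_2$); signatures with sorts, function and relation symbols; terms- and formulas-in-context; assertions are equations-in-context and sequents-in-context $\phi_1..\phi_n\vdash\phi\ [\Gamma]$; a theory is a set of assertions. $\mathrm{Ob}(\mathbf{FA})$: prop-categories $(\mathcal{C},P)$ ($\mathcal{C}$ with designated finite products, $P:\mathcal{C}^{op}\to\mathbf{Pos}$) with $\mathscr{L}_\omega$-algebra structures on each $P(c)$ preserved by $P(f)$, elements $Eq_c\in P(c\times c)$, maps $\Omega_{b,c}:P(b\times c)\to P(b)$ natural in $b$, such that $(P(c),\otimes,e_c)$ is a monoid, $\Omega_{b,1}\circ P(\pi_1^{b,1})=\mathrm{id}$, $\Omega_{b,c\times d}\circ P(a_{b,c,d})=\Omega_{b,c}\circ\Omega_{b\times c,d}$, $Eq_1=e_{1\times1}$, $Eq_{c_1\times c_2}=P(\langle\pi_1^{c_1,c_2}\pi_1,\pi_1^{c_1,c_2}\pi_2\rangle)(Eq_{c_1})\otimes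 P(\langle\pi_2^{c_1,c_2}\pi_1,\pi_2^{c_1,c_2}\pi_2\rangle)(Eq_{c_2})$. Structures: an $Sg$-structure interprets sorts, function and relation symbols as objects, morphisms, and elements of $P$ of products; terms as morphisms and formulas as elements of $P([\![\Gamma]\!])$ in the standard way (equality via $Eq$, quantifiers via $\Omega$ after a canonical iso). It satisfies an equation if both sides agree and a sequent if $\bigotimes[\![\phi_i]\!]\le[\![\phi]\!]$ (empty $\otimes$ is $e$). For $\mathcal{X}\subseteq\mathrm{Ob}(\mathbf{FA})$, $T\models_{\mathcal{X}}T'$ iff every $T$-model in a member of $\mathcal{X}$ satisfies all of $T'$ (so $\models_{\emptyset}$ relates all pairs). The product $(\prod_I\mathcal{C}_i,\prod_IP_i)$: objects and morphisms are families, products componentwise, $(\prod P_i)(a)=\prod_IP_i(a_i)$ with product order and componentwise operations, $Eq$, $e$, $\otimes$, $\Omega$ componentwise; for $I=\emptyset$ it is the terminal category with its unique functor. -}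

module Defs where

open import Level using (Level; _⊔_) renaming (suc to lsuc)
open import Data.Nat using (ℕ)
open import Data.Fin using (Fin; zero; suc)
open import Data.List using (List; []; _∷_)
open import Data.Product using (∃; _,_)
open import Relation.Binary using (Rel; IsEquivalence; Poset)
open import Relation.Binary.PropositionalEquality using (_≡_)
open import Relation.Unary using (Pred; _∈_; ｛_｝)

record Language : Set₁ where
  field
    Quant : Set
    Conn  : ℕ → Set
    e     : Conn 0
    ⊗     : Conn 2

infixl 5 _▸_
data Ctx (S : Set) : Set where
  ε   : Ctx S
  _▸_ : Ctx S → S → Ctx S

record Signature : Set₁ where
  field
    Sort : Set
    Fun  : Ctx Sort → Sort → Set
    Rl   : Ctx Sort → Set

module Syntax (L : Language) (Sg : Signature) where
  open Language L
  open Signature Sg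

  data Var : Ctx Sort → Sort → Set where
    vz : ∀ {Γ A} → Var (Γ ▸ A) A
    vs : ∀ {Γ A B} → Var Γ A → Var (Γ ▸ B) A

  data Term (Γ : Ctx Sort) : Sort → Set
  data Terms (Γ : Ctx Sort) : Ctx Sort → Set

  data Term Γ where
    var : ∀ {A} → Var Γ A → Term Γ A
    app : ∀ {As B} → Fun As B → Terms Γ As → Term Γ B

  data Terms Γ where
    []  : Terms Γ ε
    _,_ : ∀ {As A} → Terms Γ As → Term Γ A → Terms Γ (As ▸ A)

  data Formula (Γ : Ctx Sort) : Set where
    rel   : ∀ {As} → Rl As → Terms Γ As → Formula Γ
    eq    : ∀ {A} → Term Γ A → Term Γ A → Formula Γ
    conn  : ∀ {n} → Conn n → (Fin n → Formula Γ) → Formula Γ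
    quant : Quant → (A : Sort) → Formula (Γ ▸ A) → Formula Γ

  data Assertion : Set where
    equation : (Γ : Ctx Sort) (A : Sort) → Term Γ A → Term Γ A → Assertion
    sequent  : (Γ : Ctx Sort) → List (Formula Γ) → Formula Γ → Assertion

  Theory : (t : Level) → Set (lsuc t)
  Theory t = Pred Assertion t

record CartesianCategory (o h e : Level) : Set (lsuc (o ⊔ h ⊔ e)) where
  infixr 9 _∘_
  infix 4 _≈_
  infixr 7 _×_
  field
    Obj : Set o
    Hom : Obj → Obj → Set h
    _≈_ : ∀ {a b} → Rel (Hom a b) e
    ≈-equiv : ∀ {a b} → IsEquivalence (_≈_ {a} {b})
    id  : ∀ {a} → Hom a a
    _∘_ : ∀ {a b c} → Hom b c → Hom a b → Hom a c
    ∘-resp-≈ : ∀ {a b c} {f f' : Hom b c} {g g' : Hom a b} →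
               f ≈ f' → g ≈ g' → f ∘ g ≈ f' ∘ g'
    identityˡ : ∀ {a b} {f : Hom a b} → id ∘ f ≈ f
    identityʳ : ∀ {a b} {f : Hom a b} → f ∘ id ≈ f
    assoc : ∀ {a b c d} {f : Hom a b} {g : Hom b c} {k : Hom c d} →
            (k ∘ g) ∘ f ≈ k ∘ (g ∘ f)
    𝟙 : Obj
    ! : ∀ {a} → Hom a 𝟙
    !-unique : ∀ {a} (f : Hom a 𝟙) → f ≈ !
    _×_ : Obj → Obj → Obj
    π₁ : ∀ {a b} → Hom (a × b) a
    π₂ : ∀ {a b} → Hom (a × b) b
    ⟨_,_⟩ : ∀ {a b c} → Hom c a → Hom c b → Hom c (a × b)
    π₁-⟨⟩ : ∀ {a b c} {f : Hom c a} {g : Hom c b} → π₁ ∘ ⟨ f , g ⟩ ≈ f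
    π₂-⟨⟩ : ∀ {a b c} {f : Hom c a} {g : Hom c b} → π₂ ∘ ⟨ f , g ⟩ ≈ g
    ⟨⟩-unique : ∀ {a b c} {f : Hom c a} {g : Hom c b} {k : Hom c (a × b)} →
                π₁ ∘ k ≈ f → π₂ ∘ k ≈ g → k ≈ ⟨ f , g ⟩

pair : ∀ {a} {A : Set a} → A → A → Fin 2 → A
pair x y zero    = x
pair x y (suc _) = y

record FA (L : Language) (o h e p q r : Level) : Set (lsuc (o ⊔ h ⊔ e ⊔ p ⊔ q ⊔ r)) where
  open Language L using (Quant; Conn) renaming (e to eᶜ; ⊗ to ⊗ᶜ)
  field
    𝒞 : CartesianCategory o h e
  open CartesianCategory 𝒞 public
  field
    P : Obj → Poset p q r

  ∣P∣ : Obj → Set p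
  ∣P∣ c = Poset.Carrier (P c)

  infix 4 _≈ₚ_ _≤ₚ_
  _≈ₚ_ : ∀ {c} → Rel (∣P∣ c) q
  _≈ₚ_ {c} = Poset._≈_ (P c)

  _≤ₚ_ : ∀ {c} → Rel (∣P∣ c) r
  _≤ₚ_ {c} = Poset._≤_ (P c)

  field
    P₁ : ∀ {a b} → Hom a b → ∣P∣ b → ∣P∣ a
    P₁-mono : ∀ {a b} (f : Hom a b) {x y : ∣P∣ b} → x ≤ₚ y → P₁ f x ≤ₚ P₁ f y
    P₁-resp : ∀ {a b} {f g : Hom a b} → f ≈ g → ∀ x → P₁ f x ≈ₚ P₁ g x
    P₁-id : ∀ {a} (x : ∣P∣ a) → P₁ id x ≈ₚ x
    P₁-∘ : ∀ {a b c} (f : Hom a b) (g : Hom b c) (x : ∣P∣ c) →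
           P₁ (g ∘ f) x ≈ₚ P₁ f (P₁ g x)

    op : ∀ {c n} → Conn n → (Fin n → ∣P∣ c) → ∣P∣ c
    op-cong : ∀ {c n} (k : Conn n) {xs ys : Fin n → ∣P∣ c} →
              (∀ i → xs i ≈ₚ ys i) → op k xs ≈ₚ op k ys
    P₁-op : ∀ {a b n} (f : Hom a b) (k : Conn n) (xs : Fin n → ∣P∣ b) →
            P₁ f (op k xs) ≈ₚ op k (λ i → P₁ f (xs i))

    Eq : ∀ c → ∣P∣ (c × c)

    Ω : Quant → ∀ {b c} → ∣P∣ (b × c) → ∣P∣ b
    Ω-mono : ∀ Q {b c} {x y : ∣P∣ (b × c)} → x ≤ₚ y → Ω Q x ≤ₚ Ω Q y
    Ω-natural : ∀ Q {a b c} (f : Hom a b) (x : ∣P∣ (b × c)) →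
                Ω Q {a} {c} (P₁ ⟨ f ∘ π₁ , π₂ ⟩ x) ≈ₚ P₁ f (Ω Q {b} {c} x)

  eₚ : ∀ {c} → ∣P∣ c
  eₚ = op eᶜ (λ ())

  infixl 6 _⊗ₚ_
  _⊗ₚ_ : ∀ {c} → ∣P∣ c → ∣P∣ c → ∣P∣ c
  x ⊗ₚ y = op ⊗ᶜ (pair x y)

  α : ∀ {b c d} → Hom (b × (c × d)) ((b × c) × d)
  α = ⟨ ⟨ π₁ , π₁ ∘ π₂ ⟩ , π₂ ∘ π₂ ⟩

  field
    ⊗-assoc : ∀ {c} (x y z : ∣P∣ c) → (x ⊗ₚ y) ⊗ₚ z ≈ₚ x ⊗ₚ (y ⊗ₚ z)
    ⊗-identityˡ : ∀ {c} (x : ∣P∣ c) → eₚ ⊗ₚ x ≈ₚ x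
    ⊗-identityʳ : ∀ {c} (x : ∣P∣ c) → x ⊗ₚ eₚ ≈ₚ x
    Ω-unit : ∀ Q {b} (x : ∣P∣ b) → Ω Q {b} {𝟙} (P₁ π₁ x) ≈ₚ x
    Ω-assoc : ∀ Q {b c d} (x : ∣P∣ ((b × c) × d)) →
              Ω Q {b} {c × d} (P₁ α x) ≈ₚ Ω Q {b} {c} (Ω Q {b × c} {d} x)
    Eq-𝟙 : Eq 𝟙 ≈ₚ eₚ
    Eq-× : ∀ c₁ c₂ → Eq (c₁ × c₂) ≈ₚ
             P₁ ⟨ π₁ ∘ π₁ , π₁ ∘ π₂ ⟩ (Eq c₁) ⊗ₚ P₁ ⟨ π₂ ∘ π₁ , π₂ ∘ π₂ ⟩ (Eq c₂)

module Semantics {L : Language} {o h e p q r : Level}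
                 (X : FA L o h e p q r) (Sg : Signature) where
  open Language L using (Quant; Conn)
  open Signature Sg
  open Syntax L Sg
  open FA X

  ctxObj : (Sort → Obj) → Ctx Sort → Obj
  ctxObj s ε       = 𝟙
  ctxObj s (Γ ▸ A) = ctxObj s Γ × s A

  record Structure : Set (o ⊔ h ⊔ p) where
    field
      sort : Sort → Obj
      fun  : ∀ {As B} → Fun As B → Hom (ctxObj sort As) (sort B)
      relᴹ : ∀ {As} → Rl As → ∣P∣ (ctxObj sort As)

  module _ (M : Structure) where
    open Structure M

    ⟦_⟧ᶜ : Ctx Sort → Obj
    ⟦_⟧ᶜ = ctxObj sort

    ⟦_⟧ᵛ : ∀ {Γ A} → Var Γ A → Hom ⟦ Γ ⟧ᶜ (sort A)
    ⟦ vz ⟧ᵛ   = π₂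
    ⟦ vs v ⟧ᵛ = ⟦ v ⟧ᵛ ∘ π₁

    ⟦_⟧ᵗ : ∀ {Γ A} → Term Γ A → Hom ⟦ Γ ⟧ᶜ (sort A)
    ⟦_⟧ᵗˢ : ∀ {Γ As} → Terms Γ As → Hom ⟦ Γ ⟧ᶜ ⟦ As ⟧ᶜ
    ⟦ var v ⟧ᵗ    = ⟦ v ⟧ᵛ
    ⟦ app f ts ⟧ᵗ = fun f ∘ ⟦ ts ⟧ᵗˢ
    ⟦ [] ⟧ᵗˢ      = !
    ⟦ ts , t ⟧ᵗˢ  = ⟨ ⟦ ts ⟧ᵗˢ , ⟦ t ⟧ᵗ ⟩

    ⟦_⟧ᶠ : ∀ {Γ} → Formula Γ → ∣P∣ ⟦ Γ ⟧ᶜ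
    ⟦ rel R ts ⟧ᶠ     = P₁ ⟦ ts ⟧ᵗˢ (relᴹ R)
    ⟦ eq {A} t s ⟧ᶠ   = P₁ ⟨ ⟦ t ⟧ᵗ , ⟦ s ⟧ᵗ ⟩ (Eq (sort A))
    ⟦ conn k φs ⟧ᶠ    = op k (λ i → ⟦ φs i ⟧ᶠ)
    ⟦ quant Q A φ ⟧ᶠ  = Ω Q ⟦ φ ⟧ᶠ

    ⨂ : ∀ {Γ} → List (Formula Γ) → ∣P∣ ⟦ Γ ⟧ᶜ
    ⨂ []       = eₚ
    ⨂ (φ ∷ []) = ⟦ φ ⟧ᶠ
    ⨂ (φ ∷ φs@(_ ∷ _)) = ⟦ φ ⟧ᶠ ⊗ₚ ⨂ φs

    Satisfies : Assertion → Set (h ⊔ e ⊔ r)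
    Satisfies (equation Γ A t s) = Level.Lift (h ⊔ r) (⟦ t ⟧ᵗ ≈ ⟦ s ⟧ᵗ)
    Satisfies (sequent Γ φs φ)   = Level.Lift (h ⊔ e) (⨂ φs ≤ₚ ⟦ φ ⟧ᶠ)

    IsModel : ∀ {t} → Theory t → Set (t ⊔ h ⊔ e ⊔ r)
    IsModel T = ∀ a → a ∈ T → Satisfies a

module _ {L : Language} {Sg : Signature} where
  open Syntax L Sg

  _⊨⟨_⟩_ : ∀ {t t' o h e p q r x} → Theory t →
           Pred (FA L o h e p q r) x → Theory t' → Set _
  T ⊨⟨ 𝒳 ⟩ T' = ∀ X → X ∈ 𝒳 → (M : Semantics.Structure X Sg) →
                 Semantics.IsModel X Sg M T → Semantics.IsModel X Sg M T'

family : ∀ {L o h e p q r ι} {I : Set ι} → (I → FA L o h e p q r) →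
         Pred (FA L o h e p q r) _
family {I = I} F X = ∃ λ (i : I) → F i ≡ X

module _ {L : Language} {o h e p q r ι : Level} (I : Set ι)
         (F : I → FA L o h e p q r) where
  private
    module F (i : I) = FA (F i)

  ΠCat : CartesianCategory (ι ⊔ o) (ι ⊔ h) (ι ⊔ e)
  ΠCat = record
    { Obj = (i : I) → F.Obj i
    ; Hom = λ a b → (i : I) → F.Hom i (a i) (b i)
    ; _≈_ = λ f g → (i : I) → F._≈_ i (f i) (g i)
    ; ≈-equiv = record
        { refl  = λ i → IsEquivalence.refl (F.≈-equiv i)
        ; sym   = λ x i → IsEquivalence.sym (F.≈-equiv i) (x i)
        ; trans = λ x y i → IsEquivalence.trans (F.≈-equiv i) (x i) (y i) }
    ; id  = λ i → F.id i
    ; _∘_ = λ f g i → F._∘_ i (f i) (g i)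
    ; ∘-resp-≈ = λ x y i → F.∘-resp-≈ i (x i) (y i)
    ; identityˡ = λ i → F.identityˡ i
    ; identityʳ = λ i → F.identityʳ i
    ; assoc = λ i → F.assoc i
    ; 𝟙 = λ i → F.𝟙 i
    ; ! = λ i → F.! i
    ; !-unique = λ f i → F.!-unique i (f i)
    ; _×_ = λ a b i → F._×_ i (a i) (b i)
    ; π₁ = λ i → F.π₁ i
    ; π₂ = λ i → F.π₂ i
    ; ⟨_,_⟩ = λ f g i → F.⟨_,_⟩ i (f i) (g i)
    ; π₁-⟨⟩ = λ i → F.π₁-⟨⟩ i
    ; π₂-⟨⟩ = λ i → F.π₂-⟨⟩ i
    ; ⟨⟩-unique = λ x y i → F.⟨⟩-unique i (x i) (y i)
    }

  ΠPoset : ((i : I) → F.Obj i) → Poset (ι ⊔ p) (ι ⊔ q) (ι ⊔ r)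
  ΠPoset a = record
    { Carrier = (i : I) → F.∣P∣ i (a i)
    ; _≈_ = λ x y → (i : I) → F._≈ₚ_ i (x i) (y i)
    ; _≤_ = λ x y → (i : I) → F._≤ₚ_ i (x i) (y i)
    ; isPartialOrder = record
        { isPreorder = record
            { isEquivalence = record
                { refl  = λ i → Poset.Eq.refl (F.P i (a i))
                ; sym   = λ x i → Poset.Eq.sym (F.P i (a i)) (x i)
                ; trans = λ x y i → Poset.Eq.trans (F.P i (a i)) (x i) (y i) }
            ; reflexive = λ x i → Poset.reflexive (F.P i (a i)) (x i)
            ; trans = λ x y i → Poset.trans (F.P i (a i)) (x i) (y i) }
        ; antisym = λ x y i → Poset.antisym (F.P i (a i)) (x i) (y i) }
    }

  private
    ≈trans : ∀ i {c} {x y z : F.∣P∣ i c} →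
             F._≈ₚ_ i x y → F._≈ₚ_ i y z → F._≈ₚ_ i x z
    ≈trans i {c} = Poset.Eq.trans (F.P i c)

    ≈sym : ∀ i {c} {x y : F.∣P∣ i c} → F._≈ₚ_ i x y → F._≈ₚ_ i y x
    ≈sym i {c} = Poset.Eq.sym (F.P i c)

    e-comp : ∀ i {c} (xs : Fin 0 → F.∣P∣ i c) →
             F._≈ₚ_ i (F.op i (Language.e L) xs) (F.eₚ i)
    e-comp i xs = F.op-cong i (Language.e L) (λ ())

    ⊗Π : {c : (k : I) → F.Obj k} → ((k : I) → F.∣P∣ k (c k)) →
         ((k : I) → F.∣P∣ k (c k)) → (k : I) → F.∣P∣ k (c k)
    ⊗Π x y k = F.op k (Language.⊗ L) (λ j → pair x y j k)

    pair-comp : ∀ i (c : (k : I) → F.Obj k) (x y : (k : I) → F.∣P∣ k (c k)) (j : Fin 2) →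
                F._≈ₚ_ i (pair x y j i) (pair (x i) (y i) j)
    pair-comp i c x y zero    = Poset.Eq.refl (F.P i (c i))
    pair-comp i c x y (suc _) = Poset.Eq.refl (F.P i (c i))

    ⊗-comp : ∀ i (c : (k : I) → F.Obj k) (x y : (k : I) → F.∣P∣ k (c k)) →
             F._≈ₚ_ i (F.op i (Language.⊗ L) (λ j → pair x y j i))
                      (F._⊗ₚ_ i (x i) (y i))
    ⊗-comp i c x y = F.op-cong i (Language.⊗ L) (pair-comp i c x y)

  ΠFA : FA L (ι ⊔ o) (ι ⊔ h) (ι ⊔ e) (ι ⊔ p) (ι ⊔ q) (ι ⊔ r)
  ΠFA = record
    { 𝒞 = ΠCat
    ; P = ΠPoset
    ; P₁ = λ f x i → F.P₁ i (f i) (x i)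
    ; P₁-mono = λ f x i → F.P₁-mono i (f i) (x i)
    ; P₁-resp = λ x y i → F.P₁-resp i (x i) (y i)
    ; P₁-id = λ x i → F.P₁-id i (x i)
    ; P₁-∘ = λ f g x i → F.P₁-∘ i (f i) (g i) (x i)
    ; op = λ k xs i → F.op i k (λ j → xs j i)
    ; op-cong = λ k x i → F.op-cong i k (λ j → x j i)
    ; P₁-op = λ f k xs i → F.P₁-op i (f i) k (λ j → xs j i)
    ; Eq = λ c i → F.Eq i (c i)
    ; Ω = λ Q x i → F.Ω i Q (x i)
    ; Ω-mono = λ Q x i → F.Ω-mono i Q (x i)
    ; Ω-natural = λ Q f x i → F.Ω-natural i Q (f i) (x i)
    ; ⊗-assoc = λ {c} x y z i →
        ≈trans i (≈trans i (⊗-comp i c (⊗Π x y) z)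
                    (F.op-cong i (Language.⊗ L)
                       (λ { zero → ⊗-comp i c x y ; (suc _) → Poset.Eq.refl (F.P i (c i)) })))
          (≈trans i (F.⊗-assoc i (x i) (y i) (z i))
             (≈sym i (≈trans i (⊗-comp i c x (⊗Π y z))
                (F.op-cong i (Language.⊗ L)
                   (λ { zero → Poset.Eq.refl (F.P i (c i)) ; (suc _) → ⊗-comp i c y z })))))
    ; ⊗-identityˡ = λ {c} x i →
        ≈trans i (⊗-comp i c _ x)
          (≈trans i (F.op-cong i (Language.⊗ L)
                       (λ { zero → e-comp i _ ; (suc _) → Poset.Eq.refl (F.P i (c i)) }))
             (F.⊗-identityˡ i (x i)))
    ; ⊗-identityʳ = λ {c} x i →
        ≈trans i (⊗-comp i c x _)
          (≈trans i (F.op-cong i (Language.⊗ L)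
                       (λ { zero → Poset.Eq.refl (F.P i (c i)) ; (suc _) → e-comp i _ }))
             (F.⊗-identityʳ i (x i)))
    ; Ω-unit = λ Q x i → F.Ω-unit i Q (x i)
    ; Ω-assoc = λ Q x i → F.Ω-assoc i Q (x i)
    ; Eq-𝟙 = λ i → ≈trans i (F.Eq-𝟙 i) (≈sym i (e-comp i _))
    ; Eq-× = λ c₁ c₂ i → ≈trans i (F.Eq-× i (c₁ i) (c₂ i)) (≈sym i (⊗-comp i (λ k → F._×_ k (F._×_ k (c₁ k) (c₂ k)) (F._×_ k (c₁ k) (c₂ k))) _ _))
    }

{-# OPTIONS --safe #-}
module Submission where

open import Defs
open import Level using (Level; lift; lower)
open import Relation.Unary using (｛_｝)
open import Data.Fin using (Fin; zero; suc)
open import Data.List using (List; []; _∷_)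
open import Data.Product using (_,_)
open import Function using (_⇔_; mk⇔; Equivalence)
open import Relation.Binary using (Poset)
open import Relation.Binary.PropositionalEquality
  using (_≡_; refl; cong; cong₂; trans; subst; subst₂)

-- Everything in the product is componentwise, so a structure M in it is a family of
-- structures in the factors and M satisfies an assertion iff every component does. The only
-- friction: the i-th component of M's ⟦ Γ ⟧ is equal to the factor's ⟦ Γ ⟧ only
-- propositionally, so each interpretation clause is compared up to transport along it.

module Transport {L : Language} {o h e p q r : Level} (X : FA L o h e p q r) where
  open FA X
  open Language L using (Conn)

  subst-π₂ : ∀ {a a' b} (c : a ≡ a') → π₂ {a'} {b} ≡ subst₂ Hom (cong (_× b) c) refl π₂
  subst-π₂ refl = refl

  subst-∘π₁ : ∀ {a a' b} (c : a ≡ a') (f : Hom a b) {d} →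
              subst₂ Hom c refl f ∘ π₁ {a'} {d} ≡ subst₂ Hom (cong (_× d) c) refl (f ∘ π₁)
  subst-∘π₁ refl f = refl

  subst-! : ∀ {a a'} (c : a ≡ a') → ! {a'} ≡ subst₂ Hom c refl !
  subst-! refl = refl

  subst-∘ : ∀ {a a' x x' y} (c : a ≡ a') (d : x ≡ x') (f : Hom x y) (g : Hom a x) →
            subst₂ Hom d refl f ∘ subst₂ Hom c d g ≡ subst₂ Hom c refl (f ∘ g)
  subst-∘ refl refl f g = refl

  subst-⟨⟩ : ∀ {a a' x x' y} (c : a ≡ a') (d : x ≡ x') (f : Hom a x) (g : Hom a y) →
             ⟨ subst₂ Hom c d f , subst₂ Hom c refl g ⟩ ≡ subst₂ Hom c (cong (_× y) d) ⟨ f , g ⟩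
  subst-⟨⟩ refl refl f g = refl

  subst-P₁ : ∀ {a a' x x'} (c : a ≡ a') (d : x ≡ x') (f : Hom a x) (y : ∣P∣ x) →
             P₁ (subst₂ Hom c d f) (subst ∣P∣ d y) ≡ subst ∣P∣ c (P₁ f y)
  subst-P₁ refl refl f y = refl

  subst-op-cong : ∀ {a a' n} (c : a ≡ a') (k : Conn n)
                  {xs : Fin n → ∣P∣ a'} {ys : Fin n → ∣P∣ a} →
                  (∀ j → xs j ≈ₚ subst ∣P∣ c (ys j)) → op k xs ≈ₚ subst ∣P∣ c (op k ys)
  subst-op-cong refl k xs≈ys = op-cong k xs≈ys

  -- The right side is op ⊗ zs rather than a ⊗ₚ b: at a component, the product's ⊗ₚ is only
  -- pointwise equal to the factor's.
  subst-⊗-cong : ∀ {a a'} (c : a ≡ a') {x y : ∣P∣ a'} {zs : Fin 2 → ∣P∣ a} →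
                 x ≈ₚ subst ∣P∣ c (zs zero) → y ≈ₚ subst ∣P∣ c (zs (suc zero)) →
                 x ⊗ₚ y ≈ₚ subst ∣P∣ c (op (Language.⊗ L) zs)
  subst-⊗-cong c x≈ y≈ = subst-op-cong c _ λ { zero → x≈ ; (suc zero) → y≈ }

  subst-Ω-cong : ∀ {a a'} (c : a ≡ a') Q {d} {x : ∣P∣ (a' × d)} {y : ∣P∣ (a × d)} →
                 x ≈ₚ subst ∣P∣ (cong (_× d) c) y → Ω Q x ≈ₚ subst ∣P∣ c (Ω Q y)
  subst-Ω-cong {a} refl Q {d} x≈y =
    antisym (Ω-mono Q (reflexive x≈y)) (Ω-mono Q (reflexive (Eq.sym x≈y)))
    where open Poset (P (a × d)) using (reflexive; module Eq)
          open Poset (P a) using (antisym)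

  subst-≤⇔ : ∀ {a a'} (c : a ≡ a') {x y : ∣P∣ a} {x' y' : ∣P∣ a'} →
             x' ≈ₚ subst ∣P∣ c x → y' ≈ₚ subst ∣P∣ c y → x ≤ₚ y ⇔ x' ≤ₚ y'
  subst-≤⇔ {a} refl x'≈x y'≈y = mk⇔
    (λ x≤y → ≤-respˡ-≈ (Eq.sym x'≈x) (≤-respʳ-≈ (Eq.sym y'≈y) x≤y))
    (λ x'≤y' → ≤-respˡ-≈ x'≈x (≤-respʳ-≈ y'≈y x'≤y'))
    where open Poset (P a)

  subst-≈⇔ : ∀ {a a' b} (c : a ≡ a') {f g : Hom a b} →
             f ≈ g ⇔ subst₂ Hom c refl f ≈ subst₂ Hom c refl g
  subst-≈⇔ refl = mk⇔ (λ f≈g → f≈g) (λ f≈g → f≈g)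

module Components {L : Language} {Sg : Signature} {o h e p q r ι : Level}
                  (I : Set ι) (F : I → FA L o h e p q r)
                  (M : Semantics.Structure (ΠFA I F) Sg) where
  open Syntax L Sg
  module Π = Semantics (ΠFA I F) Sg
  open Π.Structure M

  module _ (i : I) where
    module Fᵢ = FA (F i)
    module Sᵢ = Semantics (F i) Sg
    open Transport (F i)

    ctxObj-component : ∀ Γ → Π.ctxObj sort Γ i ≡ Sᵢ.ctxObj (λ A → sort A i) Γ
    ctxObj-component ε       = refl
    ctxObj-component (Γ ▸ A) = cong (Fᵢ._× sort A i) (ctxObj-component Γ)

    component : Sᵢ.Structure
    component = record
      { sort = λ A → sort A i
      ; fun  = λ {As} f → subst₂ Fᵢ.Hom (ctxObj-component As) refl (fun f i)
      ; relᴹ = λ {As} R → subst Fᵢ.∣P∣ (ctxObj-component As) (relᴹ R i)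
      }

    var-component : ∀ {Γ A} (v : Var Γ A) →
                    Sᵢ.⟦_⟧ᵛ component v ≡ subst₂ Fᵢ.Hom (ctxObj-component Γ) refl (Π.⟦_⟧ᵛ M v i)
    var-component {Γ ▸ _} vz     = subst-π₂ (ctxObj-component Γ)
    var-component {Γ ▸ _} (vs v) =
      trans (cong (Fᵢ._∘ Fᵢ.π₁) (var-component v)) (subst-∘π₁ (ctxObj-component Γ) _)

    term-component : ∀ {Γ A} (t : Term Γ A) →
                     Sᵢ.⟦_⟧ᵗ component t ≡ subst₂ Fᵢ.Hom (ctxObj-component Γ) refl (Π.⟦_⟧ᵗ M t i)
    terms-component : ∀ {Γ As} (ts : Terms Γ As) →
                      Sᵢ.⟦_⟧ᵗˢ component ts ≡
                      subst₂ Fᵢ.Hom (ctxObj-component Γ) (ctxObj-component As) (Π.⟦_⟧ᵗˢ M ts i)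
    term-component (var v) = var-component v
    term-component {Γ} (app {As} f ts) =
      trans (cong (_ Fᵢ.∘_) (terms-component ts))
            (subst-∘ (ctxObj-component Γ) (ctxObj-component As) _ _)
    terms-component {Γ} [] = subst-! (ctxObj-component Γ)
    terms-component {Γ} (_,_ {As} ts t) =
      trans (cong₂ Fᵢ.⟨_,_⟩ (terms-component ts) (term-component t))
            (subst-⟨⟩ (ctxObj-component Γ) (ctxObj-component As) _ _)

    formula-component : ∀ {Γ} (φ : Formula Γ) →
                        Sᵢ.⟦_⟧ᶠ component φ Fᵢ.≈ₚ subst Fᵢ.∣P∣ (ctxObj-component Γ) (Π.⟦_⟧ᶠ M φ i)
    formula-component {Γ} (rel {As} R ts) = Poset.Eq.reflexive (Fᵢ.P _)
      (trans (cong (λ f → Fᵢ.P₁ f _) (terms-component ts))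
             (subst-P₁ (ctxObj-component Γ) (ctxObj-component As) _ _))
    formula-component {Γ} (eq t s) = Poset.Eq.reflexive (Fᵢ.P _)
      (trans (cong₂ (λ f g → Fᵢ.P₁ Fᵢ.⟨ f , g ⟩ _) (term-component t) (term-component s))
      (trans (cong (λ f → Fᵢ.P₁ f _) (subst-⟨⟩ (ctxObj-component Γ) refl _ _))
             (subst-P₁ (ctxObj-component Γ) refl _ _)))
    formula-component {Γ} (conn k φs) =
      subst-op-cong (ctxObj-component Γ) k (λ j → formula-component (φs j))
    formula-component {Γ} (quant Q A φ) =
      subst-Ω-cong (ctxObj-component Γ) Q (formula-component φ)

    ⨂-component : ∀ {Γ} (φs : List (Formula Γ)) →
                  Sᵢ.⨂ component φs Fᵢ.≈ₚ subst Fᵢ.∣P∣ (ctxObj-component Γ) (Π.⨂ M φs i)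
    ⨂-component {Γ} []           = subst-op-cong (ctxObj-component Γ) _ (λ ())
    ⨂-component     (φ ∷ [])     = formula-component φ
    ⨂-component {Γ} (φ ∷ φs@(_ ∷ _)) =
      subst-⊗-cong (ctxObj-component Γ) (formula-component φ) (⨂-component φs)

    equation-component : ∀ {Γ A} (t s : Term Γ A) →
                         Π.⟦_⟧ᵗ M t i Fᵢ.≈ Π.⟦_⟧ᵗ M s i ⇔
                         Sᵢ.⟦_⟧ᵗ component t Fᵢ.≈ Sᵢ.⟦_⟧ᵗ component s
    equation-component {Γ} t s rewrite term-component t | term-component s =
      subst-≈⇔ (ctxObj-component Γ)

    sequent-component : ∀ {Γ} (φs : List (Formula Γ)) (φ : Formula Γ) →
                        Π.⨂ M φs i Fᵢ.≤ₚ Π.⟦_⟧ᶠ M φ i ⇔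
                        Sᵢ.⨂ component φs Fᵢ.≤ₚ Sᵢ.⟦_⟧ᶠ component φ
    sequent-component {Γ} φs φ =
      subst-≤⇔ (ctxObj-component Γ) (⨂-component φs) (formula-component φ)

  satisfies⇔components : ∀ a →
                         Π.Satisfies M a ⇔ (∀ i → Semantics.Satisfies (F i) Sg (component i) a)
  satisfies⇔components (equation Γ A t s) = mk⇔
    (λ (lift t≈s) i → lift (Equivalence.to (equation-component i t s) (t≈s i)))
    (λ t≈s → lift λ i → Equivalence.from (equation-component i t s) (lower (t≈s i)))
  satisfies⇔components (sequent Γ φs φ) = mk⇔
    (λ (lift φs≤φ) i → lift (Equivalence.to (sequent-component i φs φ) (φs≤φ i)))
    (λ φs≤φ → lift λ i → Equivalence.from (sequent-component i φs φ) (lower (φs≤φ i)))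

mainTheorem11 : {L : Language} {Sg : Signature} {o h e p q r ι t t' : Level}
                (I : Set ι) (F : I → FA L o h e p q r)
                (T : Syntax.Theory L Sg t) (T' : Syntax.Theory L Sg t') →
                T ⊨⟨ family F ⟩ T' → T ⊨⟨ ｛ ΠFA I F ｝ ⟩ T'
mainTheorem11 I F T T' T⊨T' .(ΠFA I F) refl M M⊨T a a∈T' =
  Equivalence.from (satisfies⇔components a) λ i →
    T⊨T' (F i) (i , refl) (component i)
         (λ b b∈T → Equivalence.to (satisfies⇔components b) (M⊨T b b∈T) i) a a∈T'
  where open Components I F M
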